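{- Let $G$ be a $k$-probe threshold graph without a $k$-probe module. Then $G$ has at most $2^{k+1}+k$ maximal vertices.
   Context: A graph is a threshold graph if it has no induced subgraph isomorphic to $P_4$, $C_4$ or $2K_2$. For independent sets $\mathbb{N}_1,\dots,\mathbb{N}_k$ of $G=(V,E)$, an embedding is a graph $H=(V,F)$ with $E\subseteq F$ such that every edge of $F\setminus E$ has both endpoints in some $\mathbb{N}_i$; $G$ is a $k$-probe threshold graph if for some $k$ independent sets it has an embedding which is a threshold graph. A false module is a set of vertices any two of which have the same open neighborhood; a true module is a set of vertices any two of which have the same closed neighborhood. A $k$-probe module is a false module with at least $3$ vertices or a true module with at least $k+3$ vertices. A vertex $x$ is maximal if there is no vertex $y$ with $N(x) \subsetneq N(y)$ and no vertex $y$ with $N[x] \subsetneq N[y]$, where $N(\cdot)$ and $N[\cdot]$ denote open and closed neighborhoods in $G$. -}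

module Defs where

open import Data.Nat using (ℕ; suc; _+_; _^_; _≤_)
open import Data.Fin using (Fin; _≟_)
open import Data.Fin.Subset using (Subset; _∈_; ∣_∣)
open import Data.Bool using (Bool; true; false; _∨_)
open import Data.Product using (Σ; ∃; ∃-syntax; _×_)
open import Data.Sum using (_⊎_)
open import Relation.Nullary using (¬_)
open import Relation.Nullary.Decidable using (⌊_⌋)
open import Relation.Binary.PropositionalEquality using (_≡_; _≢_)

record Graph (n : ℕ) : Set where
  field
    adj   : Fin n → Fin n → Bool
    sym   : ∀ x y → adj x y ≡ adj y x
    irefl : ∀ x → adj x x ≡ false
open Graph public

Edge : ∀ {n} → Graph n → Fin n → Fin n → Set
Edge G x y = adj G x y ≡ true

NonEdge : ∀ {n} → Graph n → Fin n → Fin n → Set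
NonEdge G x y = adj G x y ≡ false

Distinct4 : ∀ {n} → Fin n → Fin n → Fin n → Fin n → Set
Distinct4 a b c d = a ≢ b × a ≢ c × a ≢ d × b ≢ c × b ≢ d × c ≢ d

InducedP4 : ∀ {n} → Graph n → Fin n → Fin n → Fin n → Fin n → Set
InducedP4 G a b c d = Distinct4 a b c d
  × Edge G a b × Edge G b c × Edge G c d
  × NonEdge G a c × NonEdge G b d × NonEdge G a d

InducedC4 : ∀ {n} → Graph n → Fin n → Fin n → Fin n → Fin n → Set
InducedC4 G a b c d = Distinct4 a b c d
  × Edge G a b × Edge G b c × Edge G c d × Edge G d a
  × NonEdge G a c × NonEdge G b d

Induced2K2 : ∀ {n} → Graph n → Fin n → Fin n → Fin n → Fin n → Set
Induced2K2 G a b c d = Distinct4 a b c d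
  × Edge G a b × Edge G c d
  × NonEdge G a c × NonEdge G a d × NonEdge G b c × NonEdge G b d

IsThreshold : ∀ {n} → Graph n → Set
IsThreshold G = ∀ a b c d →
  ¬ InducedP4 G a b c d × ¬ InducedC4 G a b c d × ¬ Induced2K2 G a b c d

Independent : ∀ {n} → Graph n → Subset n → Set
Independent G S = ∀ x y → x ∈ S → y ∈ S → NonEdge G x y

IsEmbedding : ∀ {n k} → Graph n → (Fin k → Subset n) → Graph n → Set
IsEmbedding {k = k} G N H =
  (∀ x y → Edge G x y → Edge H x y) ×
  (∀ x y → Edge H x y → NonEdge G x y → ∃[ i ] (x ∈ N i × y ∈ N i))

IsKProbeThreshold : ∀ {n} → ℕ → Graph n → Set
IsKProbeThreshold {n} k G = Σ (Fin k → Subset n) λ N →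
  (∀ i → Independent G (N i)) ×
  Σ (Graph n) λ H → IsEmbedding G N H × IsThreshold H

closedAdj : ∀ {n} → Graph n → Fin n → Fin n → Bool
closedAdj G x z = ⌊ z ≟ x ⌋ ∨ adj G x z

IsFalseModule : ∀ {n} → Graph n → Subset n → Set
IsFalseModule G S = ∀ x y → x ∈ S → y ∈ S → ∀ z → adj G x z ≡ adj G y z

IsTrueModule : ∀ {n} → Graph n → Subset n → Set
IsTrueModule G S = ∀ x y → x ∈ S → y ∈ S → ∀ z → closedAdj G x z ≡ closedAdj G y z

IsKProbeModule : ∀ {n} → ℕ → Graph n → Subset n → Set
IsKProbeModule k G S =
  (IsFalseModule G S × 3 ≤ ∣ S ∣) ⊎ (IsTrueModule G S × k + 3 ≤ ∣ S ∣)

StrictSub : ∀ {n} → (Fin n → Bool) → (Fin n → Bool) → Set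
StrictSub A B = (∀ z → A z ≡ true → B z ≡ true) × ∃[ z ] (B z ≡ true × A z ≡ false)

IsMaximal : ∀ {n} → Graph n → Fin n → Set
IsMaximal G x =
  (∀ y → ¬ StrictSub (adj G x) (adj G y)) ×
  (∀ y → ¬ StrictSub (closedAdj G x) (closedAdj G y))

-- In a threshold graph H neighbourhoods are nested: for u ≠ v, N(u) ∖ {v} ⊆ N(v)
-- or N(v) ∖ {u} ⊆ N(u), since two crossing witnesses z₁, z₂ would induce a P4,
-- C4 or 2K2 on u, v, z₁, z₂. Pull this back along the embedding G ⊆ H. Two
-- maximal vertices of G lying in exactly the same (nonempty) family of probe
-- sets Nᵢ are false twins: an H-edge yz missing from G puts y and z into a common
-- Nᵢ, which also contains x, so xz is no G-edge either. Two maximal vertices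
-- lying in no Nᵢ are false or true twins, because H and G agree at them.
-- Hence each of the 2^k − 1 nonempty probe patterns spans a false module, of
-- size at most 2, and the unprobed maximal vertices form a false or a true
-- module, of size at most k + 2; in total 2 (2^k − 1) + k + 2 = 2^(k+1) + k.
module Submission where

open import Defs
open import Data.Nat using (ℕ; zero; suc; _+_; _*_; _^_; _≤_; s≤s⁻¹)
open import Data.Nat.Properties using (≤-trans; ≤-reflexive; +-mono-≤; ≰⇒>; +-comm; +-suc; *-identityʳ; m≤m+n; module ≤-Reasoning)
open import Data.Nat.Tactic.RingSolver using (solve-∀)
open import Data.Fin using (Fin; zero; suc; _≟_)
open import Data.Fin.Subset using (Subset; _∈_; _∉_; _⊆_; ∣_∣; _∩_; ∁; inside; outside)
open import Data.Fin.Subset.Properties using (_∈?_; ⊆-trans; p∩q⊆p; p∩q⊆q; x∈∁p⇒x∉p)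
open import Data.Fin.Properties using (any?)
open import Data.Bool using (Bool; true; false; _∨_)
open import Data.Bool.Properties using (∨-zeroʳ) renaming (_≟_ to _≟ᵇ_)
open import Data.Product using (_×_; _,_; proj₁; proj₂; ∃; ∃-syntax)
open import Data.Sum using (_⊎_; inj₁; inj₂; [_,_])
open import Data.Empty using (⊥; ⊥-elim)
open import Data.Vec using (_∷_; [])
open import Relation.Nullary using (¬_; Dec; yes; no)
open import Relation.Nullary.Decidable using (_×-dec_; ¬?)
open import Relation.Binary.PropositionalEquality using (_≡_; _≢_; refl; trans; cong; subst; ≢-sym) renaming (sym to ≡-sym)

true≢false : ∀ {b} → b ≡ true → b ≡ false → ⊥
true≢false refl ()

adj-sym : ∀ {n} (G : Graph n) {x y b} → adj G x y ≡ b → adj G y x ≡ b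
adj-sym G {x} {y} e = trans (Graph.sym G y x) e

edge⇒≢ : ∀ {n} (G : Graph n) {x y} → Edge G x y → x ≢ y
edge⇒≢ G {x} e refl = true≢false e (irefl G x)

closedAdj-refl : ∀ {n} (G : Graph n) x → closedAdj G x x ≡ true
closedAdj-refl G x with x ≟ x
... | yes _   = refl
... | no x≢x = ⊥-elim (x≢x refl)

closedAdj-≢ : ∀ {n} (G : Graph n) {x z} → z ≢ x → closedAdj G x z ≡ adj G x z
closedAdj-≢ G {x} {z} z≢x with z ≟ x
... | yes z≡x = ⊥-elim (z≢x z≡x)
... | no _    = refl

⊆∧¬StrictSub⇒≡ : ∀ {n} {A B : Fin n → Bool} → (∀ z → A z ≡ true → B z ≡ true) →
  ¬ StrictSub A B → ∀ z → A z ≡ B z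
⊆∧¬StrictSub⇒≡ {A = A} {B} A⊆B ¬A⊂B z with A z in Az | B z in Bz
... | true  | true  = refl
... | false | false = refl
... | true  | false = ⊥-elim (true≢false (A⊆B z Az) Bz)
... | false | true  = ⊥-elim (¬A⊂B (A⊆B , z , Bz , Az))

∣p∣≡∣p∩q∣+∣p∩∁q∣ : ∀ {n} (p q : Subset n) → ∣ p ∣ ≡ ∣ p ∩ q ∣ + ∣ p ∩ ∁ q ∣
∣p∣≡∣p∩q∣+∣p∩∁q∣ []            []            = refl
∣p∣≡∣p∩q∣+∣p∩∁q∣ (inside  ∷ p) (inside  ∷ q) = cong suc (∣p∣≡∣p∩q∣+∣p∩∁q∣ p q)
∣p∣≡∣p∩q∣+∣p∩∁q∣ (inside  ∷ p) (outside ∷ q) =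
  trans (cong suc (∣p∣≡∣p∩q∣+∣p∩∁q∣ p q)) (≡-sym (+-suc ∣ p ∩ q ∣ ∣ p ∩ ∁ q ∣))
∣p∣≡∣p∩q∣+∣p∩∁q∣ (outside ∷ p) (inside  ∷ q) = ∣p∣≡∣p∩q∣+∣p∩∁q∣ p q
∣p∣≡∣p∩q∣+∣p∩∁q∣ (outside ∷ p) (outside ∷ q) = ∣p∣≡∣p∩q∣+∣p∩∁q∣ p q

Homogeneous : ∀ {n k} → (Fin k → Subset n) → Subset n → Set
Homogeneous N T = ∀ i {x y} → x ∈ T → y ∈ T → x ∈ N i → y ∈ N i

Disjoint : ∀ {n} → Subset n → Subset n → Set
Disjoint T U = ∀ {x} → x ∈ T → x ∉ U

DisjointFromAll : ∀ {n k} → (Fin k → Subset n) → Subset n → Set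
DisjointFromAll N T = ∀ i → Disjoint T (N i)

homogeneous-suc : ∀ {n k} {N : Fin (suc k) → Subset n} {T} →
  T ⊆ N zero ⊎ Disjoint T (N zero) → Homogeneous (λ i → N (suc i)) T → Homogeneous N T
homogeneous-suc (inj₁ T⊆N₀) _ zero _ y∈T _ = T⊆N₀ y∈T
homogeneous-suc (inj₂ T∩N₀≡∅) _ zero x∈T _ x∈N₀ = ⊥-elim (T∩N₀≡∅ x∈T x∈N₀)
homogeneous-suc _ hom (suc i) = hom i

disjointFromAll-suc : ∀ {n k} {N : Fin (suc k) → Subset n} {T} →
  Disjoint T (N zero) → DisjointFromAll (λ i → N (suc i)) T → DisjointFromAll N T
disjointFromAll-suc T∩N₀≡∅ _ zero = T∩N₀≡∅
disjointFromAll-suc _ disjoint (suc i) = disjoint i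

disjointFromAll⇒homogeneous : ∀ {n k} {N : Fin k → Subset n} {T} →
  DisjointFromAll N T → Homogeneous N T
disjointFromAll⇒homogeneous disjoint i x∈T _ x∈Nᵢ = ⊥-elim (disjoint i x∈T x∈Nᵢ)

card≤-by-membership-classes : ∀ {n} k (N : Fin k → Subset n) (S : Subset n) (a c : ℕ) →
  (∀ {T} → T ⊆ S → Homogeneous N T → ∀ i → T ⊆ N i → ∣ T ∣ ≤ a) →
  (∀ {T} → T ⊆ S → DisjointFromAll N T → ∣ T ∣ ≤ a + c) →
  ∣ S ∣ ≤ a * 2 ^ k + c
card≤-by-membership-classes zero N S a c _ disjoint-bound =
  subst (λ m → ∣ S ∣ ≤ m + c) (≡-sym (*-identityʳ a)) (disjoint-bound (λ x∈S → x∈S) (λ ()))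
card≤-by-membership-classes (suc k) N S a c homogeneous-bound disjoint-bound = begin
  ∣ S ∣                                ≡⟨ ∣p∣≡∣p∩q∣+∣p∩∁q∣ S N₀ ⟩
  ∣ S ∩ N₀ ∣ + ∣ S ∩ ∁ N₀ ∣            ≤⟨ +-mono-≤ ∣S∩N₀∣≤ ∣S∩∁N₀∣≤ ⟩
  (a * 2 ^ k + 0) + (a * 2 ^ k + c)    ≡⟨ doubling a (2 ^ k) c ⟩
  a * 2 ^ suc k + c                    ∎
  where
  open ≤-Reasoning
  N₀ = N zero
  N′ : Fin k → Subset _
  N′ i = N (suc i)

  doubling : ∀ a m c → (a * m + 0) + (a * m + c) ≡ a * (2 * m) + c
  doubling = solve-∀

  ⊆S : ∀ {T U} → T ⊆ S ∩ U → T ⊆ S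
  ⊆S {U = U} T⊆ = ⊆-trans T⊆ (p∩q⊆p S U)

  ⊆N₀ : ∀ {T} → T ⊆ S ∩ N₀ → T ⊆ N₀
  ⊆N₀ T⊆ = ⊆-trans T⊆ (p∩q⊆q S N₀)

  disjoint-N₀ : ∀ {T} → T ⊆ S ∩ ∁ N₀ → Disjoint T N₀
  disjoint-N₀ T⊆ x∈T = x∈∁p⇒x∉p (p∩q⊆q S (∁ N₀) (T⊆ x∈T))

  ∣S∩N₀∣≤ : ∣ S ∩ N₀ ∣ ≤ a * 2 ^ k + 0
  ∣S∩N₀∣≤ = card≤-by-membership-classes k N′ (S ∩ N₀) a 0
    (λ T⊆ hom i → homogeneous-bound (⊆S T⊆) (homogeneous-suc (inj₁ (⊆N₀ T⊆)) hom) (suc i))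
    (λ T⊆ disjoint → ≤-trans
      (homogeneous-bound (⊆S T⊆)
        (homogeneous-suc (inj₁ (⊆N₀ T⊆)) (disjointFromAll⇒homogeneous disjoint)) zero (⊆N₀ T⊆))
      (m≤m+n a 0))

  ∣S∩∁N₀∣≤ : ∣ S ∩ ∁ N₀ ∣ ≤ a * 2 ^ k + c
  ∣S∩∁N₀∣≤ = card≤-by-membership-classes k N′ (S ∩ ∁ N₀) a c
    (λ T⊆ hom i → homogeneous-bound (⊆S T⊆) (homogeneous-suc (inj₂ (disjoint-N₀ T⊆)) hom) (suc i))
    (λ T⊆ disjoint → disjoint-bound (⊆S T⊆) (disjointFromAll-suc (disjoint-N₀ T⊆) disjoint))

NbhdIncluded : ∀ {n} → Graph n → Fin n → Fin n → Set
NbhdIncluded H u v = ∀ z → z ≢ v → Edge H u z → Edge H v z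

NonInclusionWitness : ∀ {n} → Graph n → Fin n → Fin n → Fin n → Set
NonInclusionWitness H u v z = z ≢ v × Edge H u z × NonEdge H v z

nonInclusionWitness? : ∀ {n} (H : Graph n) u v z → Dec (NonInclusionWitness H u v z)
nonInclusionWitness? H u v z = ¬? (z ≟ v) ×-dec ((adj H u z ≟ᵇ true) ×-dec (adj H v z ≟ᵇ false))

∄nonInclusionWitness⇒nbhdIncluded : ∀ {n} (H : Graph n) {u v} →
  ¬ ∃ (NonInclusionWitness H u v) → NbhdIncluded H u v
∄nonInclusionWitness⇒nbhdIncluded H {u} {v} ∄w z z≢v uz with adj H v z in vz
... | true  = refl
... | false = ⊥-elim (∄w (z , z≢v , uz , vz))

module _ {n} (H : Graph n) (threshold : IsThreshold H) where

  ¬P4 : ∀ a b c d → ¬ InducedP4 H a b c d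
  ¬P4 a b c d = proj₁ (threshold a b c d)

  ¬C4 : ∀ a b c d → ¬ InducedC4 H a b c d
  ¬C4 a b c d = proj₁ (proj₂ (threshold a b c d))

  ¬2K2 : ∀ a b c d → ¬ Induced2K2 H a b c d
  ¬2K2 a b c d = proj₂ (proj₂ (threshold a b c d))

  threshold-noCrossingWitnesses : ∀ {u v z₁ z₂} → u ≢ v →
    NonInclusionWitness H u v z₁ → NonInclusionWitness H v u z₂ → ⊥
  threshold-noCrossingWitnesses {u} {v} {z₁} {z₂} u≢v (z₁≢v , uz₁ , vz₁) (z₂≢u , vz₂ , uz₂) =
    crossing (adj H u v) (adj H z₁ z₂) refl refl
    where
    u≢z₁ : u ≢ z₁
    u≢z₁ = edge⇒≢ H uz₁
    v≢z₂ : v ≢ z₂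
    v≢z₂ = edge⇒≢ H vz₂
    z₁≢z₂ : z₁ ≢ z₂
    z₁≢z₂ refl = true≢false uz₁ uz₂
    crossing : ∀ b₁ b₂ → adj H u v ≡ b₁ → adj H z₁ z₂ ≡ b₂ → ⊥
    crossing false false uv z₁z₂ = ¬2K2 u z₁ v z₂
      ((u≢z₁ , u≢v , ≢-sym z₂≢u , z₁≢v , z₁≢z₂ , v≢z₂) , uz₁ , vz₂ , uv , uz₂ , adj-sym H vz₁ , z₁z₂)
    crossing true  false uv z₁z₂ = ¬P4 z₁ u v z₂
      ((≢-sym u≢z₁ , z₁≢v , z₁≢z₂ , u≢v , ≢-sym z₂≢u , v≢z₂) , adj-sym H uz₁ , uv , vz₂ , adj-sym H vz₁ , uz₂ , z₁z₂)
    crossing false true  uv z₁z₂ = ¬P4 u z₁ z₂ v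
      ((u≢z₁ , ≢-sym z₂≢u , u≢v , z₁≢z₂ , z₁≢v , ≢-sym v≢z₂) , uz₁ , z₁z₂ , adj-sym H vz₂ , uz₂ , adj-sym H vz₁ , uv)
    crossing true  true  uv z₁z₂ = ¬C4 u z₁ z₂ v
      ((u≢z₁ , ≢-sym z₂≢u , u≢v , z₁≢z₂ , z₁≢v , ≢-sym v≢z₂) , uz₁ , z₁z₂ , adj-sym H vz₂ , adj-sym H uv , uz₂ , adj-sym H vz₁)

  threshold-nested : ∀ {u v} → u ≢ v → NbhdIncluded H u v ⊎ NbhdIncluded H v u
  threshold-nested {u} {v} u≢v
    with any? (nonInclusionWitness? H u v) | any? (nonInclusionWitness? H v u)
  ... | no ∄uv | _ = inj₁ (∄nonInclusionWitness⇒nbhdIncluded H ∄uv)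
  ... | yes _ | no ∄vu = inj₂ (∄nonInclusionWitness⇒nbhdIncluded H ∄vu)
  ... | yes (_ , w₁) | yes (_ , w₂) = ⊥-elim (threshold-noCrossingWitnesses u≢v w₁ w₂)

Twins : ∀ {n} → Graph n → Fin n → Fin n → Set
Twins G x y = (NonEdge G x y × (∀ z → adj G x z ≡ adj G y z))
            ⊎ (Edge G x y × (∀ z → closedAdj G x z ≡ closedAdj G y z))

twins-sym : ∀ {n} (G : Graph n) {x y} → Twins G x y → Twins G y x
twins-sym G (inj₁ (xy , N≡)) = inj₁ (adj-sym G xy , λ z → ≡-sym (N≡ z))
twins-sym G (inj₂ (xy , N≡)) = inj₂ (adj-sym G xy , λ z → ≡-sym (N≡ z))

module _ {n} (G : Graph n) {S : Subset n}
  (twins : ∀ {x y} → x ∈ S → y ∈ S → x ≢ y → Twins G x y) where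

  -- A third member w adjacent to u would be a true twin of both u and v, making
  -- N[u] = N[w] = N[v] and hence u, v adjacent.
  falseTwins-noNeighbourIn : ∀ {u v w} → u ∈ S → v ∈ S → w ∈ S → u ≢ v →
    NonEdge G u v → (∀ z → adj G u z ≡ adj G v z) → ¬ Edge G u w
  falseTwins-noNeighbourIn {u} {v} {w} u∈S v∈S w∈S u≢v uv N≡ uw
    with trans (≡-sym (N≡ w)) uw
  ... | vw with twins u∈S w∈S (edge⇒≢ G uw) | twins v∈S w∈S (edge⇒≢ G vw)
  ... | inj₁ (uw′ , _) | _ = true≢false uw uw′
  ... | _ | inj₁ (vw′ , _) = true≢false vw vw′
  ... | inj₂ (_ , N[u]≡N[w]) | inj₂ (_ , N[v]≡N[w]) = true≢false
    (trans (N[v]≡N[w] u) (trans (≡-sym (N[u]≡N[w] u)) (closedAdj-refl G u)))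
    (trans (closedAdj-≢ G u≢v) (adj-sym G uv))

  edgeIn⇒neighbourIn : ∀ {x₀ y₀ u} → x₀ ∈ S → y₀ ∈ S → Edge G x₀ y₀ → u ∈ S →
    ∃[ w ] (w ∈ S × Edge G u w)
  edgeIn⇒neighbourIn {x₀} {y₀} {u} x₀∈S y₀∈S x₀y₀ u∈S with u ≟ x₀
  ... | yes refl = y₀ , y₀∈S , x₀y₀
  ... | no u≢x₀ with twins u∈S x₀∈S u≢x₀
  ...   | inj₂ (ux₀ , _) = x₀ , x₀∈S , ux₀
  ...   | inj₁ (_ , N≡) = y₀ , y₀∈S , trans (N≡ y₀) x₀y₀

  pairwiseTwins⇒module : IsFalseModule G S ⊎ IsTrueModule G S
  pairwiseTwins⇒module
    with any? (λ x → any? (λ y → (x ∈? S) ×-dec ((y ∈? S) ×-dec (adj G x y ≟ᵇ true))))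
  ... | no ∄edge = inj₁ falseModule
    where
    falseModule : IsFalseModule G S
    falseModule x y x∈S y∈S z with x ≟ y
    ... | yes refl = refl
    ... | no x≢y with twins x∈S y∈S x≢y
    ...   | inj₁ (_ , N≡) = N≡ z
    ...   | inj₂ (xy , _) = ⊥-elim (∄edge (x , y , x∈S , y∈S , xy))
  ... | yes (_ , _ , x₀∈S , y₀∈S , x₀y₀) = inj₂ trueModule
    where
    trueModule : IsTrueModule G S
    trueModule u v u∈S v∈S z with u ≟ v
    ... | yes refl = refl
    ... | no u≢v with twins u∈S v∈S u≢v
    ...   | inj₂ (_ , N[]≡) = N[]≡ z
    ...   | inj₁ (uv , N≡) with edgeIn⇒neighbourIn x₀∈S y₀∈S x₀y₀ u∈S
    ...     | _ , w∈S , uw = ⊥-elim (falseTwins-noNeighbourIn u∈S v∈S w∈S u≢v uv N≡ uw)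

module ProbeEmbedding {n k} {G H : Graph n} {N : Fin k → Subset n}
  (independent : ∀ i → Independent G (N i))
  (G⊆H : ∀ x y → Edge G x y → Edge H x y)
  (newEdge-probed : ∀ x y → Edge H x y → NonEdge G x y → ∃[ i ] (x ∈ N i × y ∈ N i))
  (threshold : IsThreshold H) where

  ProbesIncluded : Fin n → Fin n → Set
  ProbesIncluded x y = ∀ i → x ∈ N i → y ∈ N i

  Unprobed : Fin n → Set
  Unprobed x = ∀ i → x ∉ N i

  neighbour∉probeSet : ∀ {x z i} → x ∈ N i → Edge G x z → z ∉ N i
  neighbour∉probeSet {x} {z} {i} x∈Nᵢ xz z∈Nᵢ = true≢false xz (independent i x z x∈Nᵢ z∈Nᵢ)

  nbhdIncluded⇒G-nbhd⊆ : ∀ {x y i} → x ∈ N i → y ∈ N i → ProbesIncluded y x →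
    NbhdIncluded H x y → ∀ z → Edge G x z → Edge G y z
  nbhdIncluded⇒G-nbhd⊆ {x} {y} x∈Nᵢ y∈Nᵢ y≼x Nx⊆Ny z xz with adj G y z in yz
  ... | true  = refl
  ... | false
    with newEdge-probed y z (Nx⊆Ny z (λ { refl → neighbour∉probeSet x∈Nᵢ xz y∈Nᵢ }) (G⊆H x z xz)) yz
  ...   | j , y∈Nⱼ , z∈Nⱼ = ⊥-elim (neighbour∉probeSet (y≼x j y∈Nⱼ) xz z∈Nⱼ)

  maximal-sameProbes⇒falseTwins : ∀ {x y i} → IsMaximal G x → IsMaximal G y →
    x ∈ N i → y ∈ N i → ProbesIncluded x y → ProbesIncluded y x →
    ∀ z → adj G x z ≡ adj G y z
  maximal-sameProbes⇒falseTwins {x} {y} (x-max , _) (y-max , _) x∈Nᵢ y∈Nᵢ x≼y y≼x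
    with x ≟ y
  ... | yes refl = λ _ → refl
  ... | no x≢y with threshold-nested H threshold x≢y
  ...   | inj₁ Nx⊆Ny = ⊆∧¬StrictSub⇒≡ (nbhdIncluded⇒G-nbhd⊆ x∈Nᵢ y∈Nᵢ y≼x Nx⊆Ny) (x-max y)
  ...   | inj₂ Ny⊆Nx = λ z →
    ≡-sym (⊆∧¬StrictSub⇒≡ (nbhdIncluded⇒G-nbhd⊆ y∈Nᵢ x∈Nᵢ x≼y Ny⊆Nx) (y-max x) z)

  unprobed-H-edge⇒G-edge : ∀ {x z} → Unprobed x → Edge H x z → Edge G x z
  unprobed-H-edge⇒G-edge {x} {z} x-unprobed xz with adj G x z in xz′
  ... | true  = refl
  ... | false with newEdge-probed x z xz xz′
  ...   | i , x∈Nᵢ , _ = ⊥-elim (x-unprobed i x∈Nᵢ)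

  maximal-nbhdIncluded-unprobed⇒twins : ∀ {x y} → IsMaximal G x → Unprobed y →
    NbhdIncluded H x y → Twins G x y
  maximal-nbhdIncluded-unprobed⇒twins {x} {y} (x-max , x-max′) y-unprobed Nx⊆Ny
    with adj G x y in xy
  ... | false = inj₁ (refl , ⊆∧¬StrictSub⇒≡ N⊆ (x-max y))
    where
    N⊆ : ∀ z → Edge G x z → Edge G y z
    N⊆ z xz with z ≟ y
    ... | yes refl = ⊥-elim (true≢false xz xy)
    ... | no z≢y = unprobed-H-edge⇒G-edge y-unprobed (Nx⊆Ny z z≢y (G⊆H x z xz))
  ... | true = inj₂ (refl , ⊆∧¬StrictSub⇒≡ N[]⊆ (x-max′ y))
    where
    N[]⊆ : ∀ z → closedAdj G x z ≡ true → closedAdj G y z ≡ true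
    N[]⊆ z xz with z ≟ x
    ... | yes refl = trans (cong (_ ∨_) (adj-sym G xy)) (∨-zeroʳ _)
    ... | no _ with z ≟ y
    ...   | yes refl = refl
    ...   | no z≢y = unprobed-H-edge⇒G-edge y-unprobed (Nx⊆Ny z z≢y (G⊆H x z xz))

  maximal-unprobed⇒twins : ∀ {x y} → IsMaximal G x → IsMaximal G y →
    Unprobed x → Unprobed y → x ≢ y → Twins G x y
  maximal-unprobed⇒twins {x} {y} x-max y-max x-unprobed y-unprobed x≢y
    with threshold-nested H threshold x≢y
  ... | inj₁ Nx⊆Ny = maximal-nbhdIncluded-unprobed⇒twins x-max y-unprobed Nx⊆Ny
  ... | inj₂ Ny⊆Nx = twins-sym G (maximal-nbhdIncluded-unprobed⇒twins y-max x-unprobed Ny⊆Nx)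

  maximal-homogeneous⇒falseModule : ∀ {T i} → (∀ {x} → x ∈ T → IsMaximal G x) →
    Homogeneous N T → T ⊆ N i → IsFalseModule G T
  maximal-homogeneous⇒falseModule maximal hom T⊆Nᵢ x y x∈T y∈T =
    maximal-sameProbes⇒falseTwins (maximal x∈T) (maximal y∈T) (T⊆Nᵢ x∈T) (T⊆Nᵢ y∈T)
      (λ j → hom j x∈T y∈T) (λ j → hom j y∈T x∈T)

  maximal-disjointFromAll⇒module : ∀ {T} → (∀ {x} → x ∈ T → IsMaximal G x) →
    DisjointFromAll N T → IsFalseModule G T ⊎ IsTrueModule G T
  maximal-disjointFromAll⇒module maximal disjoint = pairwiseTwins⇒module G
    (λ x∈T y∈T → maximal-unprobed⇒twins (maximal x∈T) (maximal y∈T)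
      (λ i → disjoint i x∈T) (λ i → disjoint i y∈T))

module NoKProbeModule {n k} {G : Graph n} (noModule : ∀ S → ¬ IsKProbeModule k G S) where

  falseModule⇒card≤2 : ∀ {S} → IsFalseModule G S → ∣ S ∣ ≤ 2
  falseModule⇒card≤2 S-false = s≤s⁻¹ (≰⇒> λ 3≤∣S∣ → noModule _ (inj₁ (S-false , 3≤∣S∣)))

  trueModule⇒card≤2+k : ∀ {S} → IsTrueModule G S → ∣ S ∣ ≤ 2 + k
  trueModule⇒card≤2+k S-true = s≤s⁻¹ (≤-trans
    (≰⇒> λ k+3≤∣S∣ → noModule _ (inj₂ (S-true , k+3≤∣S∣))) (≤-reflexive (+-comm k 3)))

  module⇒card≤2+k : ∀ {S} → IsFalseModule G S ⊎ IsTrueModule G S → ∣ S ∣ ≤ 2 + k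
  module⇒card≤2+k = [ (λ S-false → ≤-trans (falseModule⇒card≤2 S-false) (m≤m+n 2 k))
                    , trueModule⇒card≤2+k ]

mainTheorem13 : ∀ {n} (k : ℕ) (G : Graph n) →
    IsKProbeThreshold k G →
    (∀ S → ¬ IsKProbeModule k G S) →
    ∀ (M : Subset n) → (∀ x → x ∈ M → IsMaximal G x) →
    ∣ M ∣ ≤ 2 ^ (k + 1) + k
mainTheorem13 k G (N , independent , H , (G⊆H , newEdge-probed) , threshold) noModule M M-maximal =
  subst (λ e → ∣ M ∣ ≤ 2 ^ e + k) (+-comm 1 k)
    (card≤-by-membership-classes k N M 2 k
      (λ T⊆M hom i T⊆Nᵢ → falseModule⇒card≤2
        (maximal-homogeneous⇒falseModule (maximal T⊆M) hom T⊆Nᵢ))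
      (λ T⊆M disjoint → module⇒card≤2+k
        (maximal-disjointFromAll⇒module (maximal T⊆M) disjoint)))
  where
  open ProbeEmbedding {G = G} {H = H} {N = N} independent G⊆H newEdge-probed threshold
  open NoKProbeModule {G = G} noModule
  maximal : ∀ {T} → T ⊆ M → ∀ {x} → x ∈ T → IsMaximal G x
  maximal T⊆M x∈T = M-maximal _ (T⊆M x∈T)
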